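{- Let $n$ and $k$ be positive integers. Then $$(n!!)^{k}-n^{k!!}=(k!!)^{n}-k^{n!!}$$ holds if and only if $k=n$ or $(k,n)\in\{(1,2),(2,1),(1,3),(3,1),(2,3),(3,2)\}$.
   Context: For a positive integer $m$, the double factorial $m!!$ is the product of all positive integers $\le m$ having the same parity as $m$, i.e. $m!!=m(m-2)(m-4)\cdots$, ending in $1$ if $m$ is odd and in $2$ if $m$ is even. -}

module Defs where

open import Data.Nat using (ℕ; zero; suc; _*_)

_!! : ℕ → ℕ
zero !! = 1
suc zero !! = 1
suc (suc n) !! = suc (suc n) * (n !!)

{-# OPTIONS --safe #-}
module Submission where

-- Over ℕ the identity reads n!!^k + k^(n!!) = k!!^n + n^(k!!), which is symmetric in n and k,
-- so let k < n. The pairs with n ≤ 5 are settled by evaluation, and for k = 1 the identity says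
-- n!! = n, which fails once n ≥ 4. For 2 ≤ k < n with n ≥ 6 the single term k^(n!!) exceeds the
-- right-hand side: each of k!!^n and n^(k!!) is some x^e with x ≤ k^a and a·e < n!!, so twice it
-- is at most k^(n!!). The exponents come from k!! ≤ k^k and k·n < n·n < n!!; from n ≤ k^(n-1) and
-- (n-1)·k!! < n!! when k ≤ n-2; and from n ≤ k² and 2·(n-1)!! < n!! when k = n-1.

open import Defs

module Naturals where

  open import Data.Nat
  open import Data.Nat.Properties
  open import Algebra.Properties.CommutativeSemigroup *-commutativeSemigroup using (x∙yz≈y∙xz)
  open import Data.Product using (_,_)
  open import Data.Sum using (inj₁; inj₂)
  open import Relation.Binary.PropositionalEquality
  open import Relation.Nullary using (¬_; yes; no; contradiction)

  1≤n!! : ∀ n → 1 ≤ n !!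
  1≤n!! zero          = ≤-refl
  1≤n!! (suc zero)    = ≤-refl
  1≤n!! (suc (suc n)) = *-mono-≤ (m≤m+n 1 (suc n)) (1≤n!! n)

  _!!≢0 : ∀ n → NonZero (n !!)
  n !!≢0 = >-nonZero (1≤n!! n)

  !!-mono-≤ : ∀ {m n} → m ≤ n → m !! ≤ n !!
  !!-mono-≤ {n = n}     z≤n             = 1≤n!! n
  !!-mono-≤ {n = suc n} (s≤s z≤n)       = 1≤n!! (suc n)
  !!-mono-≤             (s≤s (s≤s m≤n)) = *-mono-≤ (s≤s (s≤s m≤n)) (!!-mono-≤ m≤n)

  n!!≤n^n : ∀ n → n !! ≤ n ^ n
  n!!≤n^n zero          = ≤-refl
  n!!≤n^n (suc zero)    = ≤-refl
  n!!≤n^n (suc (suc n)) = *-monoʳ-≤ (2 + n) (begin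
    n !!            ≤⟨ n!!≤n^n n ⟩
    n ^ n           ≤⟨ ^-monoˡ-≤ n (m≤n+m n 2) ⟩
    (2 + n) ^ n     ≤⟨ ^-monoʳ-≤ (2 + n) (n≤1+n n) ⟩
    (2 + n) ^ suc n ∎)
    where open ≤-Reasoning

  n*n<n!! : ∀ {n} → 6 ≤ n → n * n < n !!
  n*n<n!! 6≤n with m≤n⇒∃[o]m+o≡n 6≤n
  ... | j , refl = *-monoʳ-< (6 + j) (begin-strict
    6 + j                <⟨ +-monoʳ-≤ 7 (m≤n⇒m≤1+n (m≤m*n j 2)) ⟩
    (4 + j) * 2          ≤⟨ *-monoʳ-≤ (4 + j) (*-mono-≤ (m≤m+n 2 j) (1≤n!! j)) ⟩
    (4 + j) * (2 + j) !! ∎)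
    where open ≤-Reasoning

  2*n!!<[1+n]!! : ∀ {n} → 5 ≤ n → 2 * n !! < suc n !!
  2*n!!<[1+n]!! 5≤n with m≤n⇒∃[o]m+o≡n 5≤n
  ... | j , refl = 2*[5+j]!!<[6+j]!! j
    where
    open ≤-Reasoning
    2*[5+j]!!<[6+j]!! : ∀ j → 2 * (5 + j) !! < (6 + j) !!
    2*[5+j]!!<[6+j]!! 0             = ≤ᵇ⇒≤ _ _ _
    2*[5+j]!!<[6+j]!! 1             = ≤ᵇ⇒≤ _ _ _
    2*[5+j]!!<[6+j]!! (suc (suc j)) = begin-strict
      2 * ((7 + j) * (5 + j) !!) ≡⟨ x∙yz≈y∙xz 2 (7 + j) ((5 + j) !!) ⟩
      (7 + j) * (2 * (5 + j) !!) <⟨ *-monoʳ-< (7 + j) (2*[5+j]!!<[6+j]!! j) ⟩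
      (7 + j) * (6 + j) !!       ≤⟨ *-monoˡ-≤ ((6 + j) !!) (n≤1+n (7 + j)) ⟩
      (8 + j) * (6 + j) !!       ∎

  n<m^n : ∀ {m} → 1 < m → ∀ n → n < m ^ n
  n<m^n     _   zero    = z<s
  n<m^n {m} 1<m (suc n) = ≤-<-trans (n<m^n 1<m n) (^-monoʳ-< m 1<m (n<1+n n))

  2*x^e≤b^m : ∀ {b x} a e {m} → 2 ≤ b → x ≤ b ^ a → a * e < m → 2 * x ^ e ≤ b ^ m
  2*x^e≤b^m {b} {x} a e {m} 2≤b@(s≤s (s≤s _)) x≤bᵃ ae<m = begin
    2 * x ^ e       ≤⟨ *-mono-≤ 2≤b (^-monoˡ-≤ e x≤bᵃ) ⟩
    b * (b ^ a) ^ e ≡⟨ cong (b *_) (^-*-assoc b a e) ⟩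
    b ^ suc (a * e) ≤⟨ ^-monoʳ-≤ b ae<m ⟩
    b ^ m           ∎
    where open ≤-Reasoning

  2*m≤o⇒2*n≤o⇒m+n≤o : ∀ {m n o} → 2 * m ≤ o → 2 * n ≤ o → m + n ≤ o
  2*m≤o⇒2*n≤o⇒m+n≤o {m} {n} {o} 2m≤o 2n≤o = *-cancelˡ-≤ 2 (begin
    2 * (m + n)   ≡⟨ *-distribˡ-+ 2 m n ⟩
    2 * m + 2 * n ≤⟨ +-mono-≤ 2m≤o 2n≤o ⟩
    o + o         ≡⟨ cong (o +_) (+-identityʳ o) ⟨
    2 * o         ∎)
    where open ≤-Reasoning

  2*k!!^n≤k^n!! : ∀ {k n} → 2 ≤ k → k < n → 6 ≤ n → 2 * (k !!) ^ n ≤ k ^ (n !!)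
  2*k!!^n≤k^n!! {k} {n} 2≤k k<n 6≤n =
    2*x^e≤b^m k n 2≤k (n!!≤n^n k) (≤-<-trans (*-monoˡ-≤ n (<⇒≤ k<n)) (n*n<n!! 6≤n))

  2+k≤n⇒2*n^k!!≤k^n!! : ∀ {k n} → 2 ≤ k → 2 + k ≤ n → 2 * n ^ (k !!) ≤ k ^ (n !!)
  2+k≤n⇒2*n^k!!≤k^n!! {k} {suc (suc j)} 2≤k (s≤s (s≤s k≤j)) =
    2*x^e≤b^m (suc j) (k !!) 2≤k (n<m^n 2≤k (suc j)) (begin-strict
      suc j * k !!   ≤⟨ *-monoʳ-≤ (suc j) (!!-mono-≤ k≤j) ⟩
      suc j * j !!   <⟨ *-monoˡ-< (j !!) {{j !!≢0}} (n<1+n (suc j)) ⟩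
      (2 + j) * j !! ∎)
    where open ≤-Reasoning

  5≤k⇒2*[1+k]^k!!≤k^[1+k]!! : ∀ {k} → 5 ≤ k → 2 * suc k ^ (k !!) ≤ k ^ (suc k !!)
  5≤k⇒2*[1+k]^k!!≤k^[1+k]!! {k} 5≤k@(s≤s (s≤s _)) = 2*x^e≤b^m 2 (k !!) (s≤s (s≤s z≤n))
    (subst (suc k ≤_) (sym (cong (k *_) (*-identityʳ k))) (m<m*n k k (s≤s (s≤s z≤n))))
    (2*n!!<[1+n]!! 5≤k)

  2*n^k!!≤k^n!! : ∀ {k n} → 2 ≤ k → k < n → 6 ≤ n → 2 * n ^ (k !!) ≤ k ^ (n !!)
  2*n^k!!≤k^n!! 2≤k k<n 6≤n with m≤n⇒m<n∨m≡n k<n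
  ... | inj₁ 2+k≤n = 2+k≤n⇒2*n^k!!≤k^n!! 2≤k 2+k≤n
  ... | inj₂ refl  = 5≤k⇒2*[1+k]^k!!≤k^[1+k]!! (s≤s⁻¹ 6≤n)

  Balanced : ℕ → ℕ → Set
  Balanced n k = (n !!) ^ k + k ^ (n !!) ≡ (k !!) ^ n + n ^ (k !!)

  data Exceptional : ℕ → ℕ → Set where
    1-2 : Exceptional 1 2
    1-3 : Exceptional 1 3
    2-3 : Exceptional 2 3

  n≤5⇒Exceptional : ∀ {k n} → 1 ≤ k → k < n → n ≤ 5 → Balanced n k → Exceptional k n
  n≤5⇒Exceptional {1} {2} _ _ _ _ = 1-2
  n≤5⇒Exceptional {1} {3} _ _ _ _ = 1-3
  n≤5⇒Exceptional {2} {3} _ _ _ _ = 2-3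
  n≤5⇒Exceptional {1} {4} _ _ _ ()
  n≤5⇒Exceptional {1} {5} _ _ _ ()
  n≤5⇒Exceptional {2} {4} _ _ _ ()
  n≤5⇒Exceptional {2} {5} _ _ _ ()
  n≤5⇒Exceptional {3} {4} _ _ _ ()
  n≤5⇒Exceptional {3} {5} _ _ _ ()
  n≤5⇒Exceptional {4} {5} _ _ _ ()
  n≤5⇒Exceptional {0}                              () _                                _ _
  n≤5⇒Exceptional {suc _}                       {1} _  (s≤s ())                         _ _
  n≤5⇒Exceptional {suc (suc _)}                 {2} _  (s≤s (s≤s ()))                   _ _
  n≤5⇒Exceptional {suc (suc (suc _))}           {3} _  (s≤s (s≤s (s≤s ())))             _ _
  n≤5⇒Exceptional {suc (suc (suc (suc _)))}     {4} _  (s≤s (s≤s (s≤s (s≤s ()))))       _ _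
  n≤5⇒Exceptional {suc (suc (suc (suc (suc _))))} {5} _ (s≤s (s≤s (s≤s (s≤s (s≤s ()))))) _ _
  n≤5⇒Exceptional {n = suc (suc (suc (suc (suc (suc _)))))} _ _ (s≤s (s≤s (s≤s (s≤s (s≤s ()))))) _

  6≤n⇒¬Balanced : ∀ {k n} → 1 ≤ k → k < n → 6 ≤ n → ¬ Balanced n k
  6≤n⇒¬Balanced {1} {n} _ _ 6≤n eq = <⇒≢ n<n!! (sym n!!≡n)
    where
    open ≡-Reasoning
    n!!≡n : n !! ≡ n
    n!!≡n = suc-injective (begin
      1 + n !!                ≡⟨ +-comm 1 (n !!) ⟩
      n !! + 1                ≡⟨ cong₂ _+_ (^-identityʳ (n !!)) (^-zeroˡ (n !!)) ⟨
      (n !!) ^ 1 + 1 ^ (n !!) ≡⟨ eq ⟩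
      1 ^ n + n ^ 1           ≡⟨ cong₂ _+_ (^-zeroˡ n) (^-identityʳ n) ⟩
      1 + n                   ∎)
    n<n!! : n < n !!
    n<n!! = ≤-<-trans (m≤m*n n n {{>-nonZero (≤-trans (s≤s z≤n) 6≤n)}}) (n*n<n!! 6≤n)
  6≤n⇒¬Balanced {k@(suc (suc _))} {n} _ k<n 6≤n eq = <-irrefl refl (begin-strict
    k ^ (n !!)                <⟨ m<n+m (k ^ (n !!)) (m^n>0 (n !!) {{n !!≢0}} k) ⟩
    (n !!) ^ k + k ^ (n !!)   ≡⟨ eq ⟩
    (k !!) ^ n + n ^ (k !!)   ≤⟨ 2*m≤o⇒2*n≤o⇒m+n≤o {(k !!) ^ n} {n ^ (k !!)}
                                   (2*k!!^n≤k^n!! 2≤k k<n 6≤n) (2*n^k!!≤k^n!! 2≤k k<n 6≤n) ⟩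
    k ^ (n !!)                ∎)
    where
    open ≤-Reasoning
    2≤k : 2 ≤ k
    2≤k = s≤s (s≤s z≤n)

  Balanced⇒Exceptional : ∀ {k n} → 1 ≤ k → k < n → Balanced n k → Exceptional k n
  Balanced⇒Exceptional {n = n} 1≤k k<n eq with n ≤? 5
  ... | yes n≤5 = n≤5⇒Exceptional 1≤k k<n n≤5 eq
  ... | no  n≰5 = contradiction eq (6≤n⇒¬Balanced 1≤k k<n (≰⇒> n≰5))

module Integers where

  open import Data.Nat using (zero; suc)
  import Data.Nat as ℕ
  open import Data.Integer
  open import Data.Integer.Properties using (pos-*; +-comm)
  open import Data.Integer.Tactic.RingSolver using (solve-∀)
  open import Relation.Binary.PropositionalEquality

  pos-^ : ∀ a e → (+ a) ^ e ≡ + (a ℕ.^ e)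
  pos-^ a zero    = refl
  pos-^ a (suc e) = trans (cong (+ a *_) (pos-^ a e)) (sym (pos-* a (a ℕ.^ e)))

  i-j≡k-l⇒i+l≡k+j : ∀ i j k l → i - j ≡ k - l → i + l ≡ k + j
  i-j≡k-l⇒i+l≡k+j i j k l eq = begin
    i + l             ≡⟨ regroup i j l ⟩
    (i - j) + (j + l) ≡⟨ cong₂ _+_ eq (+-comm j l) ⟩
    (k - l) + (l + j) ≡⟨ regroup k l j ⟨
    k + j             ∎
    where
    open ≡-Reasoning
    regroup : ∀ x y z → x + z ≡ (x - y) + (y + z)
    regroup = solve-∀

open import Data.Nat using (ℕ; suc; _≤_)
open import Data.Integer using (ℤ; +_; _-_; _^_)
open import Data.Product using (_×_; _,_)
open import Data.Sum using (_⊎_)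
open import Relation.Binary.PropositionalEquality using (_≡_)
open import Function.Bundles using (_⇔_)

import Data.Nat as ℕ
import Data.Integer as ℤ
open import Data.Nat.Properties using (<-cmp)
open import Data.Integer.Properties using (pos-+; +-injective)
open import Data.Sum using (inj₁; inj₂)
open import Function.Base using (_∘_)
open import Function.Bundles using (mk⇔)
open import Relation.Binary.Definitions using (tri<; tri≈; tri>)
open import Relation.Binary.PropositionalEquality using (refl; sym; cong₂; module ≡-Reasoning)
open Naturals using (Balanced; Exceptional; 1-2; 1-3; 2-3; Balanced⇒Exceptional)
open Integers using (pos-^; i-j≡k-l⇒i+l≡k+j)

Equation : ℕ → ℕ → Set
Equation n k = ((+ (n !!)) ^ k) - ((+ n) ^ (k !!)) ≡ ((+ (k !!)) ^ n) - ((+ k) ^ (n !!))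

Solution : ℕ → ℕ → Set
Solution n k = k ≡ n ⊎ (k , n) ≡ (1 , 2) ⊎ (k , n) ≡ (2 , 1) ⊎ (k , n) ≡ (1 , 3)
  ⊎ (k , n) ≡ (3 , 1) ⊎ (k , n) ≡ (2 , 3) ⊎ (k , n) ≡ (3 , 2)

Equation⇒Balanced : ∀ n k → Equation n k → Balanced n k
Equation⇒Balanced n k eq = +-injective (begin
  + (N ℕ.^ k ℕ.+ k ℕ.^ N)          ≡⟨ pos-+ (N ℕ.^ k) (k ℕ.^ N) ⟩
  + (N ℕ.^ k) ℤ.+ + (k ℕ.^ N)      ≡⟨ cong₂ ℤ._+_ (pos-^ N k) (pos-^ k N) ⟨
  (+ N) ^ k ℤ.+ (+ k) ^ N          ≡⟨ i-j≡k-l⇒i+l≡k+j ((+ N) ^ k) ((+ n) ^ K) ((+ K) ^ n) ((+ k) ^ N) eq ⟩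
  (+ K) ^ n ℤ.+ (+ n) ^ K          ≡⟨ cong₂ ℤ._+_ (pos-^ K n) (pos-^ n K) ⟩
  + (K ℕ.^ n) ℤ.+ + (n ℕ.^ K)      ≡⟨ pos-+ (K ℕ.^ n) (n ℕ.^ K) ⟨
  + (K ℕ.^ n ℕ.+ n ℕ.^ K)          ∎)
  where
  open ≡-Reasoning
  N = n !!
  K = k !!

Exceptional⇒Solution : ∀ {k n} → Exceptional k n → Solution n k
Exceptional⇒Solution 1-2 = inj₂ (inj₁ refl)
Exceptional⇒Solution 1-3 = inj₂ (inj₂ (inj₂ (inj₁ refl)))
Exceptional⇒Solution 2-3 = inj₂ (inj₂ (inj₂ (inj₂ (inj₂ (inj₁ refl)))))

Exceptional⇒Solution-sym : ∀ {k n} → Exceptional n k → Solution n k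
Exceptional⇒Solution-sym 1-2 = inj₂ (inj₂ (inj₁ refl))
Exceptional⇒Solution-sym 1-3 = inj₂ (inj₂ (inj₂ (inj₂ (inj₁ refl))))
Exceptional⇒Solution-sym 2-3 = inj₂ (inj₂ (inj₂ (inj₂ (inj₂ (inj₂ refl)))))

Balanced⇒Solution : ∀ {n k} → 1 ≤ n → 1 ≤ k → Balanced n k → Solution n k
Balanced⇒Solution {n} {k} 1≤n 1≤k eq with <-cmp k n
... | tri< k<n _   _   = Exceptional⇒Solution (Balanced⇒Exceptional 1≤k k<n eq)
... | tri≈ _   k≡n _   = inj₁ k≡n
... | tri> _   _   n<k = Exceptional⇒Solution-sym (Balanced⇒Exceptional 1≤n n<k (sym eq))

Solution⇒Equation : ∀ n k → Solution n k → Equation n k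
Solution⇒Equation n .n (inj₁ refl)                                        = refl
Solution⇒Equation _ _  (inj₂ (inj₁ refl))                                 = refl
Solution⇒Equation _ _  (inj₂ (inj₂ (inj₁ refl)))                          = refl
Solution⇒Equation _ _  (inj₂ (inj₂ (inj₂ (inj₁ refl))))                   = refl
Solution⇒Equation _ _  (inj₂ (inj₂ (inj₂ (inj₂ (inj₁ refl)))))            = refl
Solution⇒Equation _ _  (inj₂ (inj₂ (inj₂ (inj₂ (inj₂ (inj₁ refl))))))     = refl
Solution⇒Equation _ _  (inj₂ (inj₂ (inj₂ (inj₂ (inj₂ (inj₂ refl))))))     = refl

theorem1p3 : (n k : ℕ) → 1 ≤ n → 1 ≤ k →
    (((+ (n !!)) ^ k) - ((+ n) ^ (k !!)) ≡ ((+ (k !!)) ^ n) - ((+ k) ^ (n !!)))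
      ⇔ (k ≡ n ⊎ (k , n) ≡ (1 , 2) ⊎ (k , n) ≡ (2 , 1) ⊎ (k , n) ≡ (1 , 3)
          ⊎ (k , n) ≡ (3 , 1) ⊎ (k , n) ≡ (2 , 3) ⊎ (k , n) ≡ (3 , 2))
theorem1p3 n k 1≤n 1≤k = mk⇔ (Balanced⇒Solution 1≤n 1≤k ∘ Equation⇒Balanced n k) (Solution⇒Equation n k)
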